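{- For every $n\ge 1$, the poset $(\mathrm{Div}(a_\emptyset^{\,n-1}),\preceq)$ is isomorphic to the Tamari poset $(\mathcal{T}_n,\le_{\mathcal T})$. Moreover, the poset $\bigl(\bigcup_{n\ge 1}\mathrm{Div}(a_\emptyset^{\,n}),\preceq\bigr)$ is isomorphic to $(\mathcal{T}_\infty,\le_{\mathcal T})$.
   Context: Trees: finite binary rooted trees; $\bullet$ is the one-leaf tree and $T_0\wedge T_1$ is the tree with left subtree $T_0$ and right subtree $T_1$; the size of a tree is its number of internal nodes. An address is a finite word over $\{0,1\}$ ($\emptyset$ the empty one); the $\alpha$-subtree of $T$ is defined by: the $\emptyset$-subtree is $T$, and for $T=T_0\wedge T_1$ the $i\beta$-subtree ($i\in\{0,1\}$) is the $\beta$-subtree of $T_i$. A left rotation at $\alpha$ replaces an $\alpha$-subtree of the form $T_0\wedge(T_1\wedge T_2)$ by $(T_0\wedge T_1)\wedge T_2$. $\mathcal T_n$ is the set of size-$n$ trees, and $T\le_{\mathcal T}T'$ means $T'$ is obtained from $T$ by finitely many (possibly zero) left rotations. $\mathcal T_\infty$ is the direct limit of the posets $(\mathcal T_n,\le_{\mathcal T})$ under the embeddings $\iota_n:\mathcal T_n\to\mathcal T_{n+1}$ that replace the rightmost leaf $\bullet$ by $\bullet\wedge\bullet$, with the induced order. Thompson's group $F$: the group of orientation-preserving piecewise-linear homeomorphisms of $[0,1]$ with finitely many breakpoints, all having dyadic rational coordinates, and all slopes integral powers of $2$; the product $fg$ means $f$ followed by $g$, i.e. $(fg)(t)=g(f(t))$.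 Let $x_0\in F$ be $t\mapsto t/2$ on $[0,\frac12]$, $t\mapsto t-\frac14$ on $[\frac12,\frac34]$, $t\mapsto 2t-1$ on $[\frac34,1]$. For an address $\alpha=e_1\cdots e_k$ let $I_\alpha=[s,s+2^{ -k}]$ with $s=\sum_j e_j2^{ -j}$, and let $a_\alpha\in F$ be the identity outside $I_\alpha$ and $\varphi_\alpha^{ -1}\circ x_0\circ\varphi_\alpha$ on $I_\alpha$, where $\varphi_\alpha:I_\alpha\to[0,1]$ is the increasing affine bijection. (Then $a_\alpha$ acts on trees as left rotation at $\alpha$.) The symmetric Thompson monoid $F^+_{\mathrm{sym}}$ is the submonoid of $F$ generated by all $a_\alpha$. For $f,g\in F^+_{\mathrm{sym}}$, $f\preceq g$ (left-divisibility) means $g=fg'$ for some $g'\in F^+_{\mathrm{sym}}$; $\mathrm{Div}(f)$ is the set of all $g\in F^+_{\mathrm{sym}}$ with $g\preceq f$. -}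

module Defs where

open import Data.Nat using (ℕ; zero; suc; _+_; _∸_; _≤_)
open import Data.Bool using (Bool; true; false; if_then_else_; _∧_)
open import Data.List using (List; []; _∷_; replicate; _++_)
open import Data.Product using (Σ; ∃; ∃-syntax; _×_; _,_; proj₁; proj₂)
open import Data.Rational using (ℚ; 0ℚ; 1ℚ; ½; _≤ᵇ_)
  renaming (_+_ to _+ℚ_; _-_ to _-ℚ_; _*_ to _*ℚ_; _≤_ to _≤ℚ_)
open import Relation.Binary.PropositionalEquality using (_≡_)
open import Relation.Binary.Construct.Closure.ReflexiveTransitive using (Star)

data Tree : Set where
  • : Tree
  _∧ₜ_ : Tree → Tree → Tree

infixr 5 _∧ₜ_

size : Tree → ℕ
size • = 0
size (t ∧ₜ u) = suc (size t + size u)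

data Bit : Set where
  b0 b1 : Bit

Address : Set
Address = List Bit

data LeftRot : Address → Tree → Tree → Set where
  rot-here : ∀ t0 t1 t2 → LeftRot [] (t0 ∧ₜ (t1 ∧ₜ t2)) ((t0 ∧ₜ t1) ∧ₜ t2)
  rot-0 : ∀ {α t t'} u → LeftRot α t t' → LeftRot (b0 ∷ α) (t ∧ₜ u) (t' ∧ₜ u)
  rot-1 : ∀ {α u u'} t → LeftRot α u u' → LeftRot (b1 ∷ α) (t ∧ₜ u) (t ∧ₜ u')

OneRot : Tree → Tree → Set
OneRot t t' = Σ Address λ α → LeftRot α t t'

_≤T_ : Tree → Tree → Set
_≤T_ = Star OneRot

𝒯 : ℕ → Set
𝒯 n = Σ Tree λ t → size t ≡ n

ι : Tree → Tree
ι • = • ∧ₜ •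
ι (t ∧ₜ u) = t ∧ₜ ι u

ιⁿ : ℕ → Tree → Tree
ιⁿ zero t = t
ιⁿ (suc k) t = ι (ιⁿ k t)

-- 𝒯_∞ : direct limit of the (𝒯_n, ≤_T) along ι.
𝒯∞ : Set
𝒯∞ = Σ ℕ 𝒯

_≈∞_ : 𝒯∞ → 𝒯∞ → Set
(n , t , _) ≈∞ (m , u , _) =
  Σ ℕ λ N → (n ≤ N) × (m ≤ N) × (ιⁿ (N ∸ n) t ≡ ιⁿ (N ∸ m) u)

_≤∞_ : 𝒯∞ → 𝒯∞ → Set
(n , t , _) ≤∞ (m , u , _) =
  Σ ℕ λ N → (n ≤ N) × (m ≤ N) × (ιⁿ (N ∸ n) t ≤T ιⁿ (N ∸ m) u)

-- Thompson's group F, elements of F⁺_sym, restricted to the rationals of [0,1].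
-- (A PL homeomorphism of [0,1] is continuous, hence determined by its values
-- on ℚ ∩ [0,1].)

¼ ¾ : ℚ
¼ = ½ *ℚ ½
¾ = ½ +ℚ ¼

x₀ : ℚ → ℚ
x₀ t = if t ≤ᵇ ½ then t *ℚ ½
       else if t ≤ᵇ ¾ then t -ℚ ¼
       else (t +ℚ t) -ℚ 1ℚ

bitℚ : Bit → ℚ
bitℚ b0 = 0ℚ
bitℚ b1 = 1ℚ

halfPow : ℕ → ℚ
halfPow zero = 1ℚ
halfPow (suc k) = ½ *ℚ halfPow k

twoPow : ℕ → ℚ
twoPow zero = 1ℚ
twoPow (suc k) = twoPow k +ℚ twoPow k

len : Address → ℕ
len [] = 0
len (_ ∷ α) = suc (len α)

startAux : ℕ → Address → ℚ
startAux j [] = 0ℚ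
startAux j (e ∷ α) = (bitℚ e *ℚ halfPow (suc j)) +ℚ startAux (suc j) α

start : Address → ℚ
start = startAux 0

-- a_α : identity outside I_α = [s, s + 2^{-k}], φ_α⁻¹ ∘ x₀ ∘ φ_α on I_α
-- where φ_α(t) = (t - s) 2^k
a : Address → ℚ → ℚ
a α t =
  let s = start α ; k = len α in
  if (s ≤ᵇ t) ∧ (t ≤ᵇ (s +ℚ halfPow k))
  then s +ℚ (halfPow k *ℚ x₀ ((t -ℚ s) *ℚ twoPow k))
  else t

-- words in the generators a_α; a word [α₁,…,αₘ] denotes a_{α₁} ⋯ a_{αₘ},
-- product fg = "f followed by g", so a_{α₁} is applied first.
Word : Set
Word = List Address

eval : Word → ℚ → ℚ
eval [] t = t
eval (α ∷ w) t = eval w (a α t)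

_≈F_ : Word → Word → Set
w ≈F w' = ∀ (t : ℚ) → 0ℚ ≤ℚ t → t ≤ℚ 1ℚ → eval w t ≡ eval w' t

_⪯_ : Word → Word → Set
f ⪯ g = Σ Word λ g' → g ≈F (f ++ g')

a∅^ : ℕ → Word
a∅^ n = replicate n []

-- Div(f) (elements are words, equality is _≈F_)
Div : Word → Set
Div f = Σ Word λ g → g ⪯ f

DivUnion : Set
DivUnion = Σ Word λ g → Σ ℕ λ n → (1 ≤ n) × (g ⪯ a∅^ n)

IsoDivTamari : ℕ → Set
IsoDivTamari n =
  Σ (𝒯 n → Div (a∅^ (n ∸ 1))) λ Φ →
    (∀ T T' → proj₁ (Φ T) ≈F proj₁ (Φ T') → T ≡ T')
  × (∀ (g : Div (a∅^ (n ∸ 1))) → Σ (𝒯 n) λ T → proj₁ (Φ T) ≈F proj₁ g)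
  × (∀ T T' → (proj₁ T ≤T proj₁ T' → proj₁ (Φ T) ⪯ proj₁ (Φ T'))
            × (proj₁ (Φ T) ⪯ proj₁ (Φ T') → proj₁ T ≤T proj₁ T'))

IsoUnionTamari∞ : Set
IsoUnionTamari∞ =
  Σ (𝒯∞ → DivUnion) λ Ψ →
    (∀ x y → x ≈∞ y → proj₁ (Ψ x) ≈F proj₁ (Ψ y))
  × (∀ x y → proj₁ (Ψ x) ≈F proj₁ (Ψ y) → x ≈∞ y)
  × (∀ (g : DivUnion) → Σ 𝒯∞ λ x → proj₁ (Ψ x) ≈F proj₁ g)
  × (∀ x y → (x ≤∞ y → proj₁ (Ψ x) ⪯ proj₁ (Ψ y))
           × (proj₁ (Ψ x) ⪯ proj₁ (Ψ y) → x ≤∞ y))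

module Submission where

-- Proposition 3.9: (Div(a_∅^{n-1}), ⪯) ≅ (𝒯_n, ≤_T) for n ≥ 1, and
-- (⋃_{n≥1} Div(a_∅^n), ⪯) ≅ (𝒯_∞, ≤_T), via T ↦ the word rotating the right comb into T.
--
-- A word w in the generators acts on a tree S when the left rotations at the
-- successive addresses of w can be performed on S (Rotates w S S′).  Three facts:
-- (1) Geometric realization (module Realization): the leaves of S cut [0,1]
--     into dyadic intervals, and a_α maps the intervals of S affinely onto
--     those of the tree rotated at α.  As they cover [0,1], two words rotating
--     S into the same tree are equal in F; as they determine the tree, two
--     words acting on S and equal in F reach the same tree.
-- (2) Combs: the right comb rotates into every tree of its size, which
--     rotates into the left comb; a_∅^{n-1} rotates the right comb into the
--     left comb.  So the word of each tree divides a_∅^{n-1}.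
-- (3) Divisors act: replacing every leaf by •∧• makes short words applicable
--     and reflects ≤_T, as a tree between two doubled trees is doubled.  Hence
--     a divisor of f acts wherever f does, and divisibility of words acting on
--     a common tree is the Tamari order of the trees they reach.
-- The isomorphisms then follow directly, ι being compatible with both sides.

open import Defs
open import Data.List using (List; []; _∷_; _++_; map)
open import Data.List.Properties using (map-id; ++-assoc)
open import Data.List.Relation.Binary.Pointwise using (Pointwise; []; _∷_)
import Data.List.Relation.Binary.Pointwise as Pointwise
import Data.List.Relation.Binary.Pointwise.Properties as Pointwise
open import Data.Product using (Σ; ∃-syntax; _×_; _,_; proj₁; proj₂)
open import Data.Empty using (⊥; ⊥-elim)
open import Data.Unit using (⊤; tt)
open import Function using (id; _∘_)
open import Relation.Binary.PropositionalEquality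
  using (_≡_; refl; sym; trans; cong; cong₂; subst; subst₂)
open import Relation.Binary.Construct.Closure.ReflexiveTransitive using (ε; _◅_)

private variable
  α : Address
  b : Bit
  f g g′ h p q w w₁ w₂ : Word
  S S′ A B W W′ X X′ Y Z Z′ : Tree

data Rotates : Word → Tree → Tree → Set where
  []  : Rotates [] S S
  _∷_ : LeftRot α S X → Rotates w X Y → Rotates (α ∷ w) S Y

rotates-++ : Rotates p S X → Rotates q X Y → Rotates (p ++ q) S Y
rotates-++ []       rq = rq
rotates-++ (r ∷ rp) rq = r ∷ rotates-++ rp rq

rotates-split : ∀ p → Rotates (p ++ q) S Y → ∃[ X ] Rotates p S X × Rotates q X Y
rotates-split []      rpq      = _ , [] , rpq
rotates-split (α ∷ p) (r ∷ rpq) with rotates-split p rpq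
... | X , rp , rq = X , r ∷ rp , rq

rotates⇒≤T : Rotates w S S′ → S ≤T S′
rotates⇒≤T []      = ε
rotates⇒≤T (r ∷ rw) = (_ , r) ◅ rotates⇒≤T rw

≤T⇒rotates : S ≤T S′ → ∃[ w ] Rotates w S S′
≤T⇒rotates ε = [] , []
≤T⇒rotates ((α , r) ◅ rs) with ≤T⇒rotates rs
... | w , rw = α ∷ w , r ∷ rw

leftRot-functional : LeftRot α S A → LeftRot α S B → A ≡ B
leftRot-functional (rot-here _ _ _) (rot-here _ _ _) = refl
leftRot-functional (rot-0 u r)      (rot-0 _ r′)     = cong (_∧ₜ u) (leftRot-functional r r′)
leftRot-functional (rot-1 t r)      (rot-1 _ r′)     = cong (t ∧ₜ_) (leftRot-functional r r′)

rotates-functional : Rotates w S A → Rotates w S B → A ≡ B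
rotates-functional []       []         = refl
rotates-functional (r ∷ rw) (r′ ∷ rw′) rewrite leftRot-functional r r′ = rotates-functional rw rw′

rotates-map : (h : Address → Address) (F : Tree → Tree) →
              (∀ {α A B} → LeftRot α A B → LeftRot (h α) (F A) (F B)) →
              Rotates w A B → Rotates (map h w) (F A) (F B)
rotates-map h F f []       = []
rotates-map h F f (r ∷ rw) = f r ∷ rotates-map h F f rw

rotates-image : (F : Tree → Tree) →
                (∀ {α A B} → LeftRot α A B → LeftRot α (F A) (F B)) →
                Rotates w A B → Rotates w (F A) (F B)
rotates-image {w = w} F f rw =
  subst (λ v → Rotates v _ _) (map-id w) (rotates-map id F f rw)

inLeft : Word → Word
inLeft = map (b0 ∷_)

inRight : Word → Word
inRight = map (b1 ∷_)

rotates-inLeft : ∀ X → Rotates w A B → Rotates (inLeft w) (A ∧ₜ X) (B ∧ₜ X)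
rotates-inLeft X = rotates-map (b0 ∷_) (_∧ₜ X) (rot-0 X)

rotates-inRight : ∀ X → Rotates w A B → Rotates (inRight w) (X ∧ₜ A) (X ∧ₜ B)
rotates-inRight X = rotates-map (b1 ∷_) (X ∧ₜ_) (rot-1 X)

-- The geometric realization of trees by dyadic subdivisions of [0,1].
module Realization where

  open import Data.Bool using (Bool; true; false; if_then_else_; _∧_; T)
  open import Data.Bool.Properties using (∧-zeroʳ)
  open import Data.Nat using (suc)
  open import Data.List.Properties using (map-++; map-∘; ++-cancelˡ; map-injective; ∷-injective)
  open import Data.List.Relation.Unary.All using (All; []; _∷_)
  import Data.List.Relation.Unary.All as All
  open import Data.List.Relation.Unary.All.Properties using (++⁺; map⁺)
  open import Data.List.Relation.Unary.Any using (Any; here; there)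
  import Data.List.Relation.Unary.Any as Any
  import Data.List.Relation.Unary.Any.Properties as Any
  open import Function using (_$_)
  open import Relation.Nullary using (¬_; yes; no)
  open import Relation.Binary.PropositionalEquality using (_≢_; module ≡-Reasoning)
  open import Data.Rational using (ℚ; 0ℚ; 1ℚ; ½; _+_; _*_; _-_; -_; _≤_; _<_; _≤ᵇ_; nonNegative)
  open import Data.Rational.Properties
  open import Data.Rational.Solver using (module +-*-Solver)
  open +-*-Solver

  private variable
    t u v x y z : ℚ

  ≤ᵇ-true : x ≤ y → (x ≤ᵇ y) ≡ true
  ≤ᵇ-true {x} {y} h with x ≤ᵇ y | ≤⇒≤ᵇ h
  ... | true | _ = refl

  ≤ᵇ-false : ¬ (x ≤ y) → (x ≤ᵇ y) ≡ false
  ≤ᵇ-false {x} {y} h with x ≤ᵇ y in eq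
  ... | false = refl
  ... | true  = ⊥-elim (h (≤ᵇ⇒≤ (subst T (sym eq) tt)))

  ≤ᵇ-cong : (x ≤ y → z ≤ v) → (z ≤ v → x ≤ y) → (x ≤ᵇ y) ≡ (z ≤ᵇ v)
  ≤ᵇ-cong {x} {y} f g with x ≤? y
  ... | yes h = trans (≤ᵇ-true h) (sym (≤ᵇ-true (f h)))
  ... | no h  = trans (≤ᵇ-false h) (sym (≤ᵇ-false (λ h′ → h (g h′))))

  half : Bit → ℚ → ℚ
  half b y = ½ * (bitℚ b + y)

  unhalf : Bit → ℚ → ℚ
  unhalf b t = (t + t) - bitℚ b

  unhalf-half : ∀ b y → unhalf b (half b y) ≡ y
  unhalf-half b y =
    solve 2 (λ c y → (con ½ :* (c :+ y) :+ con ½ :* (c :+ y)) :- c := y) refl (bitℚ b) y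

  half-unhalf : ∀ b t → half b (unhalf b t) ≡ t
  half-unhalf b t =
    solve 2 (λ c t → con ½ :* (c :+ ((t :+ t) :- c)) := t) refl (bitℚ b) t

  half-mono : x ≤ y → half b x ≤ half b y
  half-mono {b = b} h = *-monoˡ-≤-nonNeg ½ (+-monoʳ-≤ (bitℚ b) h)

  unhalf-mono : x ≤ y → unhalf b x ≤ unhalf b y
  unhalf-mono {b = b} h = +-monoˡ-≤ (- bitℚ b) (+-mono-≤ h h)

  half-cancel : half b x ≤ half b y → x ≤ y
  half-cancel {b} {x} {y} h = subst₂ _≤_ (unhalf-half b x) (unhalf-half b y) (unhalf-mono {b = b} h)

  ≤ᵇ-half : ∀ b x y → (half b x ≤ᵇ half b y) ≡ (x ≤ᵇ y)
  ≤ᵇ-half b x y = ≤ᵇ-cong (half-cancel {b}) (half-mono {b = b})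

  startAux-suc : ∀ j α → startAux (suc j) α ≡ ½ * startAux j α
  startAux-suc j [] = sym (*-zeroʳ ½)
  startAux-suc j (e ∷ α) rewrite startAux-suc (suc j) α =
    solve 3 (λ c h s → c :* (con ½ :* h) :+ con ½ :* s := con ½ :* (c :* h :+ s)) refl
      (bitℚ e) (halfPow (suc j)) (startAux (suc j) α)

  start-cons : ∀ b α → start (b ∷ α) ≡ half b (start α)
  start-cons b α rewrite startAux-suc 0 α =
    solve 2 (λ c s → c :* (con ½ :* con 1ℚ) :+ con ½ :* s := con ½ :* (c :+ s)) refl (bitℚ b) (start α)

  -- By definition a α = conjugate (start α) (halfPow (len α)) (twoPow (len α)):
  -- x₀ transported to I_α, given by its left end s, width w and inverse width P.
  conjugate : (s w P t : ℚ) → ℚ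
  conjugate s w P t = if (s ≤ᵇ t) ∧ (t ≤ᵇ (s + w)) then s + (w * x₀ ((t - s) * P)) else t

  half-shift : ∀ b s w → half b s + ½ * w ≡ half b (s + w)
  half-shift b s w =
    solve 3 (λ c s w → con ½ :* (c :+ s) :+ con ½ :* w := con ½ :* (c :+ (s :+ w))) refl (bitℚ b) s w

  half-difference : ∀ b s y P → (half b y - half b s) * (P + P) ≡ (y - s) * P
  half-difference b s y P =
    solve 4 (λ c s y P → (con ½ :* (c :+ y) :- con ½ :* (c :+ s)) :* (P :+ P) := (y :- s) :* P)
      refl (bitℚ b) s y P

  conjugate-half : ∀ b s w P y →
    conjugate (half b s) (½ * w) (P + P) (half b y) ≡ half b (conjugate s w P y)
  conjugate-half b s w P y = trans guard-and-argument (branches ((s ≤ᵇ y) ∧ (y ≤ᵇ (s + w))))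
    where
    image = x₀ ((y - s) * P)
    guard-and-argument : conjugate (half b s) (½ * w) (P + P) (half b y)
      ≡ (if (s ≤ᵇ y) ∧ (y ≤ᵇ (s + w)) then half b s + ½ * w * image else half b y)
    guard-and-argument =
      cong₂ (λ g z → if g then half b s + ½ * w * x₀ z else half b y)
        (cong₂ _∧_ (≤ᵇ-half b s y)
                   (trans (cong (half b y ≤ᵇ_) (half-shift b s w)) (≤ᵇ-half b y (s + w))))
        (half-difference b s y P)
    branches : ∀ g → (if g then half b s + ½ * w * image else half b y)
                     ≡ half b (if g then s + w * image else y)
    branches true  =
      solve 4 (λ c s w X → con ½ :* (c :+ s) :+ con ½ :* w :* X := con ½ :* (c :+ (s :+ w :* X)))
        refl (bitℚ b) s w image
    branches false = refl

  a-self-similar : ∀ b α y → a (b ∷ α) (half b y) ≡ half b (a α y)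
  a-self-similar b α y
    rewrite start-cons b α = conjugate-half b (start α) (halfPow (len α)) (twoPow (len α)) y

  InUnit : ℚ → Set
  InUnit t = 0ℚ ≤ t × t ≤ 1ℚ

  half-0 : ∀ b → 0ℚ ≤ half b 0ℚ
  half-0 b0 = ≤ᵇ⇒≤ tt
  half-0 b1 = ≤ᵇ⇒≤ tt

  half-1 : ∀ b → half b 1ℚ ≤ 1ℚ
  half-1 b0 = ≤ᵇ⇒≤ tt
  half-1 b1 = ≤ᵇ⇒≤ tt

  a-cons : ∀ b α t → a (b ∷ α) t ≡ half b (a α (unhalf b t))
  a-cons b α t = begin
    a (b ∷ α) t                      ≡⟨ cong (a (b ∷ α)) (sym (half-unhalf b t)) ⟩
    a (b ∷ α) (half b (unhalf b t))  ≡⟨ a-self-similar b α (unhalf b t) ⟩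
    half b (a α (unhalf b t))        ∎
    where open ≡-Reasoning

  a-fixes-≥1 : ∀ α t → 1ℚ ≤ t → a α t ≡ t
  a-fixes-≥1 [] t 1≤t with t ≤? 1ℚ
  ... | yes t≤1 rewrite ≤-antisym t≤1 1≤t = refl
  ... | no  t≰1 rewrite ≤ᵇ-false {t} {0ℚ + 1ℚ} t≰1 | ∧-zeroʳ (0ℚ ≤ᵇ t) = refl
  a-fixes-≥1 (b ∷ α) t 1≤t = begin
    a (b ∷ α) t                ≡⟨ a-cons b α t ⟩
    half b (a α (unhalf b t))  ≡⟨ cong (half b) (a-fixes-≥1 α (unhalf b t) 1≤unhalf) ⟩
    half b (unhalf b t)        ≡⟨ half-unhalf b t ⟩
    t                          ∎
    where
    open ≡-Reasoning
    1≤unhalf : 1ℚ ≤ unhalf b t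
    1≤unhalf = half-cancel {b} (≤-trans (half-1 b) (≤-trans 1≤t (≤-reflexive (sym (half-unhalf b t)))))

  a-fixes-≤0 : ∀ α t → t ≤ 0ℚ → a α t ≡ t
  a-fixes-≤0 [] t t≤0 with 0ℚ ≤? t
  ... | yes 0≤t rewrite ≤-antisym t≤0 0≤t = refl
  ... | no  0≰t rewrite ≤ᵇ-false 0≰t = refl
  a-fixes-≤0 (b ∷ α) t t≤0 = begin
    a (b ∷ α) t                ≡⟨ a-cons b α t ⟩
    half b (a α (unhalf b t))  ≡⟨ cong (half b) (a-fixes-≤0 α (unhalf b t) unhalf≤0) ⟩
    half b (unhalf b t)        ≡⟨ half-unhalf b t ⟩
    t                          ∎
    where
    open ≡-Reasoning
    unhalf≤0 : unhalf b t ≤ 0ℚ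
    unhalf≤0 = half-cancel {b} (≤-trans (≤-reflexive (half-unhalf b t)) (≤-trans t≤0 (half-0 b)))

  a-fixes-other-half : ∀ {b b′} → b ≢ b′ → ∀ α y → InUnit y → a (b ∷ α) (half b′ y) ≡ half b′ y
  a-fixes-other-half {b0} {b0} b≢b′ α y _ = ⊥-elim (b≢b′ refl)
  a-fixes-other-half {b1} {b1} b≢b′ α y _ = ⊥-elim (b≢b′ refl)
  a-fixes-other-half {b0} {b1} _ α y (0≤y , _) = begin
    a (b0 ∷ α) (half b1 y)                ≡⟨ a-cons b0 α (half b1 y) ⟩
    half b0 (a α (unhalf b0 (half b1 y))) ≡⟨ cong (half b0) (a-fixes-≥1 α _ 1≤unhalf) ⟩
    half b0 (unhalf b0 (half b1 y))       ≡⟨ half-unhalf b0 (half b1 y) ⟩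
    half b1 y                             ∎
    where
    open ≡-Reasoning
    1≤unhalf : 1ℚ ≤ unhalf b0 (half b1 y)
    1≤unhalf = unhalf-mono {x = half b1 0ℚ} {b = b0} (half-mono {b = b1} 0≤y)
  a-fixes-other-half {b1} {b0} _ α y (_ , y≤1) = begin
    a (b1 ∷ α) (half b0 y)                ≡⟨ a-cons b1 α (half b0 y) ⟩
    half b1 (a α (unhalf b1 (half b0 y))) ≡⟨ cong (half b1) (a-fixes-≤0 α _ unhalf≤0) ⟩
    half b1 (unhalf b1 (half b0 y))       ≡⟨ half-unhalf b1 (half b0 y) ⟩
    half b0 y                             ∎
    where
    open ≡-Reasoning
    unhalf≤0 : unhalf b1 (half b0 y) ≤ 0ℚ
    unhalf≤0 = ≤-trans (unhalf-mono {b = b1} (half-mono {b = b0} y≤1)) (≤ᵇ⇒≤ tt)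

  a-root : InUnit t → a [] t ≡ x₀ t
  a-root {t} (0≤t , t≤1) rewrite ≤ᵇ-true 0≤t | ≤ᵇ-true {t} {0ℚ + 1ℚ} t≤1 = begin
    0ℚ + 1ℚ * x₀ ((t - 0ℚ) * 1ℚ) ≡⟨ solve 1 (λ X → con 0ℚ :+ con 1ℚ :* X := X) refl _ ⟩
    x₀ ((t - 0ℚ) * 1ℚ)           ≡⟨ cong x₀ (solve 1 (λ t → (t :- con 0ℚ) :* con 1ℚ := t) refl t) ⟩
    x₀ t                         ∎
    where open ≡-Reasoning

  x₀-left : t ≤ ½ → x₀ t ≡ t * ½
  x₀-left t≤½ rewrite ≤ᵇ-true t≤½ = refl

  x₀-middle : ½ ≤ t → t ≤ ¾ → x₀ t ≡ t - ¼
  x₀-middle {t} ½≤t t≤¾ with t ≤? ½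
  ... | yes t≤½ rewrite ≤-antisym t≤½ ½≤t = refl
  ... | no  t≰½ rewrite ≤ᵇ-false t≰½ | ≤ᵇ-true t≤¾ = refl

  x₀-right : ¾ ≤ t → x₀ t ≡ (t + t) - 1ℚ
  x₀-right {t} ¾≤t with t ≤? ¾
  ... | yes t≤¾ rewrite ≤-antisym t≤¾ ¾≤t = refl
  ... | no  t≰¾ rewrite ≤ᵇ-false t≰¾ | ≤ᵇ-false {t} {½} (λ t≤½ → t≰¾ (≤-trans t≤½ (≤ᵇ⇒≤ tt))) = refl

  -- x₀ maps the three quarters cut out by the tree •∧(•∧•) affinely onto those
  -- cut out by (•∧•)∧• : this is why a_∅ acts on trees as the root rotation.
  x₀-0 : InUnit y → x₀ (half b0 y) ≡ half b0 (half b0 y)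
  x₀-0 {y} (_ , y≤1) =
    trans (x₀-left (≤-trans (half-mono {b = b0} y≤1) (≤ᵇ⇒≤ tt)))
          (solve 1 (λ y → con ½ :* (con 0ℚ :+ y) :* con ½
                       := con ½ :* (con 0ℚ :+ con ½ :* (con 0ℚ :+ y))) refl y)

  x₀-10 : InUnit y → x₀ (half b1 (half b0 y)) ≡ half b0 (half b1 y)
  x₀-10 {y} (0≤y , y≤1) =
    trans (x₀-middle (≤-trans (≤ᵇ⇒≤ tt) (half-mono {b = b1} (half-mono {b = b0} 0≤y)))
                     (≤-trans (half-mono {b = b1} (half-mono {b = b0} y≤1)) (≤ᵇ⇒≤ tt)))
          (solve 1 (λ y → con ½ :* (con 1ℚ :+ con ½ :* (con 0ℚ :+ y)) :- con ¼
                       := con ½ :* (con 0ℚ :+ con ½ :* (con 1ℚ :+ y))) refl y)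

  x₀-11 : InUnit y → x₀ (half b1 (half b1 y)) ≡ half b1 y
  x₀-11 {y} (0≤y , _) =
    trans (x₀-right (≤-trans (≤ᵇ⇒≤ tt) (half-mono {b = b1} (half-mono {b = b1} 0≤y))))
          (solve 1 (λ y → let t = con ½ :* (con 1ℚ :+ con ½ :* (con 1ℚ :+ y)) in
                         (t :+ t) :- con 1ℚ := con ½ :* (con 1ℚ :+ y)) refl y)

  -- A piece (s , w) is the interval [s, s + w], parametrised by u ↦ s + w u.
  Piece : Set
  Piece = ℚ × ℚ

  ev : Piece → ℚ → ℚ
  ev (s , w) u = s + w * u

  sub : Bit → Piece → Piece
  sub b (s , w) = half b s , ½ * w

  ev-sub : ∀ b p u → ev (sub b p) u ≡ half b (ev p u)
  ev-sub b (s , w) u =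
    solve 4 (λ c s w u → con ½ :* (c :+ s) :+ con ½ :* w :* u := con ½ :* (c :+ (s :+ w :* u)))
      refl (bitℚ b) s w u

  -- The pieces of T: the standard dyadic intervals of its leaves, from left to right.
  pieces : Tree → List Piece
  pieces • = (0ℚ , 1ℚ) ∷ []
  pieces (t ∧ₜ u) = map (sub b0) (pieces t) ++ map (sub b1) (pieces u)

  record Proper (p : Piece) : Set where
    constructor proper
    field
      left≥0  : 0ℚ ≤ proj₁ p
      width>0 : 0ℚ < proj₂ p
      right≤1 : proj₁ p + proj₂ p ≤ 1ℚ

  sub-proper : ∀ b {p} → Proper p → Proper (sub b p)
  sub-proper b {s , w} (proper 0≤s 0<w s+w≤1) = proper
    (≤-trans (half-0 b) (half-mono {b = b} 0≤s))
    (subst (_< ½ * w) (*-zeroʳ ½) (*-monoʳ-<-pos ½ 0<w))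
    (≤-trans (≤-reflexive (half-shift b s w)) (≤-trans (half-mono {b = b} s+w≤1) (half-1 b)))

  pieces-proper : ∀ T → All Proper (pieces T)
  pieces-proper • = proper ≤-refl (positive⁻¹ 1ℚ) ≤-refl ∷ []
  pieces-proper (t ∧ₜ u) =
    ++⁺ (map⁺ (All.map (sub-proper b0) (pieces-proper t)))
        (map⁺ (All.map (sub-proper b1) (pieces-proper u)))

  ev-inUnit : ∀ {p} → Proper p → InUnit u → InUnit (ev p u)
  ev-inUnit {u} {s , w} (proper 0≤s 0<w s+w≤1) (0≤u , u≤1) =
    ≤-trans 0≤s (≤-trans (≤-reflexive (sym (+-identityʳ s))) (+-monoʳ-≤ s 0≤wu)) ,
    ≤-trans (+-monoʳ-≤ s wu≤w) s+w≤1
    where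
    instance _ = nonNegative (<⇒≤ 0<w)
    0≤wu : 0ℚ ≤ w * u
    0≤wu = subst (_≤ w * u) (*-zeroʳ w) (*-monoˡ-≤-nonNeg w 0≤u)
    wu≤w : w * u ≤ w
    wu≤w = subst (w * u ≤_) (*-identityʳ w) (*-monoˡ-≤-nonNeg w u≤1)

  record Transports (w : Word) (p p′ : Piece) : Set where
    constructor transports
    field transport : ∀ u → InUnit u → eval w (ev p u) ≡ ev p′ u
  open Transports

  transports-∷ : ∀ {α p p′ p″} → Transports (α ∷ []) p p′ → Transports w p′ p″ → Transports (α ∷ w) p p″
  transports-∷ {w} h₁ h₂ = transports λ u hu → trans (cong (eval w) (transport h₁ u hu)) (transport h₂ u hu)

  transports-sub : ∀ b {α p p′} → Transports (α ∷ []) p p′ → Transports ((b ∷ α) ∷ []) (sub b p) (sub b p′)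
  transports-sub b {α} {p} {p′} h = transports λ u hu → begin
    a (b ∷ α) (ev (sub b p) u)  ≡⟨ cong (a (b ∷ α)) (ev-sub b p u) ⟩
    a (b ∷ α) (half b (ev p u)) ≡⟨ a-self-similar b α (ev p u) ⟩
    half b (a α (ev p u))       ≡⟨ cong (half b) (transport h u hu) ⟩
    half b (ev p′ u)            ≡⟨ sym (ev-sub b p′ u) ⟩
    ev (sub b p′) u             ∎
    where open ≡-Reasoning

  transports-other-half : ∀ {b b′} → b ≢ b′ → ∀ α {p} → Proper p → Transports ((b ∷ α) ∷ []) (sub b′ p) (sub b′ p)
  transports-other-half {b} {b′} b≢b′ α {p} pp = transports λ u hu → begin
    a (b ∷ α) (ev (sub b′ p) u)  ≡⟨ cong (a (b ∷ α)) (ev-sub b′ p u) ⟩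
    a (b ∷ α) (half b′ (ev p u)) ≡⟨ a-fixes-other-half b≢b′ α (ev p u) (ev-inUnit pp hu) ⟩
    half b′ (ev p u)             ≡⟨ sym (ev-sub b′ p u) ⟩
    ev (sub b′ p) u              ∎
    where open ≡-Reasoning

  transports-root : ∀ {p q r} (F G : ℚ → ℚ) → Proper p → Proper q →
    (∀ u → ev q u ≡ F (ev p u)) → (∀ u → ev r u ≡ G (ev p u)) →
    (∀ {y} → InUnit y → x₀ (F y) ≡ G y) → Transports ([] ∷ []) q r
  transports-root {p} {q} {r} F G pp pq eq er x₀FG = transports λ u hu → begin
    a [] (ev q u)     ≡⟨ a-root (ev-inUnit pq hu) ⟩
    x₀ (ev q u)       ≡⟨ cong x₀ (eq u) ⟩
    x₀ (F (ev p u))   ≡⟨ x₀FG (ev-inUnit pp hu) ⟩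
    G (ev p u)        ≡⟨ sym (er u) ⟩
    ev r u            ∎
    where open ≡-Reasoning

  ev-sub² : ∀ b b′ p u → ev (sub b (sub b′ p)) u ≡ half b (half b′ (ev p u))
  ev-sub² b b′ p u = trans (ev-sub b (sub b′ p) u) (cong (half b) (ev-sub b′ p u))

  transports-map : ∀ b {α xs ys} → Pointwise (Transports (α ∷ [])) xs ys →
    Pointwise (Transports ((b ∷ α) ∷ [])) (map (sub b) xs) (map (sub b) ys)
  transports-map b []         = []
  transports-map b (h ∷ hs) = transports-sub b h ∷ transports-map b hs

  diagonal-map : ∀ {P : Piece → Set} {R : Piece → Piece → Set} (f g : Piece → Piece) →
    (∀ {x} → P x → R (f x) (g x)) → ∀ {xs} → All P xs → Pointwise R (map f xs) (map g xs)
  diagonal-map f g h []       = []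
  diagonal-map f g h (px ∷ pxs) = h px ∷ diagonal-map f g h pxs

  rotation-transports : ∀ {α} → LeftRot α S B → Pointwise (Transports (α ∷ [])) (pieces S) (pieces B)
  rotation-transports (rot-here t₀ t₁ t₂) =
    subst₂ (Pointwise (Transports ([] ∷ []))) (sym before) (sym after)
      (Pointwise.++⁺ (diagonal-map {R = T∅} (sub b0) (sub b0 ∘ sub b0) part₀ (pieces-proper t₀))
      (Pointwise.++⁺ (diagonal-map {R = T∅} (sub b1 ∘ sub b0) (sub b0 ∘ sub b1) part₁ (pieces-proper t₁))
                     (diagonal-map {R = T∅} (sub b1 ∘ sub b1) (sub b1) part₂ (pieces-proper t₂))))
    where
    P₀ = pieces t₀ ; P₁ = pieces t₁ ; P₂ = pieces t₂
    T∅ = Transports ([] ∷ [])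
    before : pieces (t₀ ∧ₜ (t₁ ∧ₜ t₂)) ≡ map (sub b0) P₀ ++ (map (sub b1 ∘ sub b0) P₁ ++ map (sub b1 ∘ sub b1) P₂)
    before = cong (map (sub b0) P₀ ++_)
      (trans (map-++ (sub b1) (map (sub b0) P₁) (map (sub b1) P₂))
             (sym (cong₂ _++_ (map-∘ P₁) (map-∘ P₂))))
    after : pieces ((t₀ ∧ₜ t₁) ∧ₜ t₂) ≡ map (sub b0 ∘ sub b0) P₀ ++ (map (sub b0 ∘ sub b1) P₁ ++ map (sub b1) P₂)
    after = trans (cong (_++ map (sub b1) P₂)
                    (trans (map-++ (sub b0) (map (sub b0) P₀) (map (sub b1) P₁))
                           (sym (cong₂ _++_ (map-∘ P₀) (map-∘ P₁)))))
                  (++-assoc (map (sub b0 ∘ sub b0) P₀) (map (sub b0 ∘ sub b1) P₁) (map (sub b1) P₂))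
    part₀ : ∀ {p} → Proper p → Transports ([] ∷ []) (sub b0 p) (sub b0 (sub b0 p))
    part₀ {p} pp = transports-root (half b0) (half b0 ∘ half b0) pp (sub-proper b0 pp)
      (ev-sub b0 p) (ev-sub² b0 b0 p) x₀-0
    part₁ : ∀ {p} → Proper p → Transports ([] ∷ []) (sub b1 (sub b0 p)) (sub b0 (sub b1 p))
    part₁ {p} pp = transports-root (half b1 ∘ half b0) (half b0 ∘ half b1) pp (sub-proper b1 (sub-proper b0 pp))
      (ev-sub² b1 b0 p) (ev-sub² b0 b1 p) x₀-10
    part₂ : ∀ {p} → Proper p → Transports ([] ∷ []) (sub b1 (sub b1 p)) (sub b1 p)
    part₂ {p} pp = transports-root (half b1 ∘ half b1) (half b1) pp (sub-proper b1 (sub-proper b1 pp))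
      (ev-sub² b1 b1 p) (ev-sub b1 p) x₀-11
  rotation-transports (rot-0 {α} u r) =
    Pointwise.++⁺ (transports-map b0 (rotation-transports r))
                  (diagonal-map {R = Transports ((b0 ∷ α) ∷ [])} (sub b1) (sub b1)
                     (transports-other-half {b0} {b1} (λ ()) α) (pieces-proper u))
  rotation-transports (rot-1 {α} t r) =
    Pointwise.++⁺ (diagonal-map {R = Transports ((b1 ∷ α) ∷ [])} (sub b0) (sub b0)
                     (transports-other-half {b1} {b0} (λ ()) α) (pieces-proper t))
                  (transports-map b1 (rotation-transports r))

  rotates-transport : Rotates w S B → Pointwise (Transports w) (pieces S) (pieces B)
  rotates-transport []       = Pointwise.refl (transports λ u _ → refl)
  rotates-transport (r ∷ rw) = Pointwise.transitive transports-∷ (rotation-transports r) (rotates-transport rw)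

  record Covers (t : ℚ) (p : Piece) : Set where
    constructor covers
    field
      param    : ℚ
      param-in : InUnit param
      hits     : ev p param ≡ t

  covers-sub : ∀ b {p} → Covers (unhalf b t) p → Covers t (sub b p)
  covers-sub {t} b {p} (covers u hu e) = covers u hu $ trans (ev-sub b p u) (trans (cong (half b) e) (half-unhalf b t))

  unhalf-inUnit : ∀ b → half b 0ℚ ≤ t → t ≤ half b 1ℚ → InUnit (unhalf b t)
  unhalf-inUnit {t} b lo hi =
    subst (_≤ unhalf b t) (unhalf-half b 0ℚ) (unhalf-mono {b = b} lo) ,
    subst (unhalf b t ≤_) (unhalf-half b 1ℚ) (unhalf-mono {b = b} hi)

  pieces-cover : ∀ T → InUnit t → Any (Covers t) (pieces T)
  pieces-cover {t} • (0≤t , t≤1) =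
    here (covers t (0≤t , t≤1) $ solve 1 (λ t → con 0ℚ :+ con 1ℚ :* t := t) refl t)
  pieces-cover {t} (T₀ ∧ₜ T₁) (0≤t , t≤1) with t ≤? ½
  ... | yes t≤½ = Any.++⁺ˡ (Any.map⁺ (Any.map (covers-sub b0)
                    (pieces-cover T₀ (unhalf-inUnit b0 0≤t t≤½))))
  ... | no  t≰½ = Any.++⁺ʳ (map (sub b0) (pieces T₀)) (Any.map⁺ (Any.map (covers-sub b1)
                    (pieces-cover T₁ (unhalf-inUnit b1 (<⇒≤ (≰⇒> t≰½)) t≤1))))

  agree-on-cover : ∀ {xs ys} → Pointwise (Transports w₁) xs ys → Pointwise (Transports w₂) xs ys →
    Any (Covers t) xs → eval w₁ t ≡ eval w₂ t
  agree-on-cover (h₁ ∷ _) (h₂ ∷ _) (here (covers u hu refl)) = trans (transport h₁ u hu) (sym (transport h₂ u hu))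
  agree-on-cover (_ ∷ hs₁) (_ ∷ hs₂) (there c) = agree-on-cover hs₁ hs₂ c

  rotations-agree : Rotates w₁ S A → Rotates w₂ S A → w₁ ≈F w₂
  rotations-agree {S = S} r₁ r₂ t 0≤t t≤1 =
    agree-on-cover (rotates-transport r₁) (rotates-transport r₂) (pieces-cover S (0≤t , t≤1))

  -- A piece is determined by the images of the endpoints 0 and 1.
  transports-determined : w₁ ≈F w₂ → ∀ {x y z} → Proper x → Transports w₁ x y → Transports w₂ x z → y ≡ z
  transports-determined E {x} {sy , wy} {sz , wz} px h₁ h₂ = cong₂ _,_ left-ends widths
    where
    agree : ∀ u → InUnit u → ev (sy , wy) u ≡ ev (sz , wz) u
    agree u hu = trans (sym (transport h₁ u hu))
      (trans (E (ev x u) (proj₁ (ev-inUnit px hu)) (proj₂ (ev-inUnit px hu))) (transport h₂ u hu))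
    at0 : ∀ s w → ev (s , w) 0ℚ ≡ s
    at0 s w = solve 2 (λ s w → s :+ w :* con 0ℚ := s) refl s w
    at1 : ∀ s w → ev (s , w) 1ℚ ≡ s + w
    at1 s w = solve 2 (λ s w → s :+ w :* con 1ℚ := s :+ w) refl s w
    left-ends : sy ≡ sz
    left-ends = trans (sym (at0 sy wy)) (trans (agree 0ℚ (≤-refl , ≤ᵇ⇒≤ tt)) (at0 sz wz))
    right-ends : sy + wy ≡ sz + wz
    right-ends = trans (sym (at1 sy wy)) (trans (agree 1ℚ (≤ᵇ⇒≤ tt , ≤-refl)) (at1 sz wz))
    widths : wy ≡ wz
    widths = trans (solve 2 (λ s w → w := (s :+ w) :- s) refl sy wy)
      (trans (cong₂ _-_ right-ends left-ends) (solve 2 (λ s w → (s :+ w) :- s := w) refl sz wz))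

  pieces-determined : w₁ ≈F w₂ → ∀ {xs ys zs} → All Proper xs →
    Pointwise (Transports w₁) xs ys → Pointwise (Transports w₂) xs zs → ys ≡ zs
  pieces-determined E []         []         []         = refl
  pieces-determined E (px ∷ pxs) (h₁ ∷ hs₁) (h₂ ∷ hs₂) =
    cong₂ _∷_ (transports-determined E px h₁ h₂) (pieces-determined E pxs hs₁ hs₂)

  Narrow LeftHalf RightHalf : Piece → Set
  Narrow p    = proj₂ p ≤ ½
  LeftHalf p  = proj₁ p < ½
  RightHalf p = ½ ≤ proj₁ p

  sub-narrow : ∀ b {p} → Proper p → Narrow (sub b p)
  sub-narrow b {s , w} (proper 0≤s _ s+w≤1) = *-monoˡ-≤-nonNeg ½ w≤1
    where
    w≤1 : w ≤ 1ℚ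
    w≤1 = ≤-trans (≤-trans (≤-reflexive (sym (+-identityˡ w))) (+-monoˡ-≤ w 0≤s)) s+w≤1

  sub-leftHalf : ∀ {p} → Proper p → LeftHalf (sub b0 p)
  sub-leftHalf {s , w} (proper _ 0<w s+w≤1) = *-monoʳ-<-pos ½ (+-monoʳ-< 0ℚ s<1)
    where
    s<1 : s < 1ℚ
    s<1 = <-≤-trans (subst (_< s + w) (+-identityʳ s) (+-monoʳ-< s 0<w)) s+w≤1

  sub-rightHalf : ∀ {p} → Proper p → RightHalf (sub b1 p)
  sub-rightHalf {s , w} (proper 0≤s _ _) = half-mono {b = b1} 0≤s

  unsub : Bit → Piece → Piece
  unsub b (s , w) = unhalf b s , unhalf b0 w

  unsub-sub : ∀ b p → unsub b (sub b p) ≡ p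
  unsub-sub b (s , w) = cong₂ _,_ (unhalf-half b s) (solve 1 (λ w → (con ½ :* w :+ con ½ :* w) :- con 0ℚ := w) refl w)

  sub-injective : ∀ b {p q} → sub b p ≡ sub b q → p ≡ q
  sub-injective b {p} {q} e = trans (sym (unsub-sub b p)) (trans (cong (unsub b) e) (unsub-sub b q))

  separated-++ : ∀ {A : Set} {P Q : A → Set} → (∀ {x} → P x → Q x → ⊥) →
    ∀ {xs xs′ ys ys′} → All P xs → All P xs′ → All Q ys → All Q ys′ → xs ++ ys ≡ xs′ ++ ys′ → xs ≡ xs′
  separated-++ P∩Q {[]}    {[]}      _          _          _        _        _ = refl
  separated-++ P∩Q {[]}    {_ ∷ _}   _          (px′ ∷ _)  (qy ∷ _) _        refl = ⊥-elim (P∩Q px′ qy)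
  separated-++ P∩Q {_ ∷ _} {[]}      (px ∷ _)   _          _        (qy′ ∷ _) refl = ⊥-elim (P∩Q px qy′)
  separated-++ P∩Q {x ∷ xs} {x′ ∷ xs′} (_ ∷ pxs) (_ ∷ pxs′) qys     qys′     e
    with refl , e′ ← ∷-injective e = cong (x ∷_) (separated-++ P∩Q pxs pxs′ qys qys′ e′)

  pieces-injective : ∀ A B → pieces A ≡ pieces B → A ≡ B
  pieces-injective • • _ = refl
  pieces-injective • (B₀ ∧ₜ B₁) e =
    ⊥-elim (leaf-is-wide (All.head (subst (All Narrow) (sym e) (node-narrow B₀ B₁))))
    where
    leaf-is-wide : ¬ (1ℚ ≤ ½)
    leaf-is-wide = ≤⇒≤ᵇ
    node-narrow : ∀ B₀ B₁ → All Narrow (pieces (B₀ ∧ₜ B₁))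
    node-narrow B₀ B₁ = ++⁺ (map⁺ (All.map (sub-narrow b0) (pieces-proper B₀)))
                            (map⁺ (All.map (sub-narrow b1) (pieces-proper B₁)))
  pieces-injective (A₀ ∧ₜ A₁) • e = sym (pieces-injective • (A₀ ∧ₜ A₁) (sym e))
  pieces-injective (A₀ ∧ₜ A₁) (B₀ ∧ₜ B₁) e =
    cong₂ _∧ₜ_ (pieces-injective A₀ B₀ (map-injective (sub-injective b0) lefts))
               (pieces-injective A₁ B₁ (map-injective (sub-injective b1) rights))
    where
    leftHalves : ∀ T → All LeftHalf (map (sub b0) (pieces T))
    leftHalves T = map⁺ (All.map sub-leftHalf (pieces-proper T))
    rightHalves : ∀ T → All RightHalf (map (sub b1) (pieces T))
    rightHalves T = map⁺ (All.map sub-rightHalf (pieces-proper T))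
    lefts : map (sub b0) (pieces A₀) ≡ map (sub b0) (pieces B₀)
    lefts = separated-++ (λ l r → <⇒≢ (<-≤-trans l r) refl)
      (leftHalves A₀) (leftHalves B₀) (rightHalves A₁) (rightHalves B₁) e
    rights : map (sub b1) (pieces A₁) ≡ map (sub b1) (pieces B₁)
    rights = ++-cancelˡ (map (sub b0) (pieces A₀)) _ _ (trans e (cong (_++ _) (sym lefts)))

  rotations-separate : Rotates w₁ S A → Rotates w₂ S B → w₁ ≈F w₂ → A ≡ B
  rotations-separate {S = S} {A = A} {B = B} r₁ r₂ E =
    pieces-injective A B (pieces-determined E (pieces-proper S) (rotates-transport r₁) (rotates-transport r₂))


open Realization using (rotations-agree; rotations-separate)

open import Data.Nat using (ℕ; zero; suc; _+_; _∸_; _≤_; z≤n; s≤s)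
open import Data.Nat.Properties
  using (+-suc; +-assoc; +-identityʳ; m∸n+n≡m; m≤m+n; m≤n+m; n≤1+n; ≡-irrelevant)

private variable
  d : ℕ

leftRot-size : LeftRot α S S′ → size S ≡ size S′
leftRot-size (rot-here t₀ t₁ t₂) =
  cong suc (trans (+-suc (size t₀) (size t₁ + size t₂)) (cong suc (sym (+-assoc (size t₀) (size t₁) (size t₂)))))
leftRot-size (rot-0 u r) = cong (λ z → suc (z + size u)) (leftRot-size r)
leftRot-size (rot-1 t r) = cong (λ z → suc (size t + z)) (leftRot-size r)

≤T-size : S ≤T S′ → size S ≡ size S′
≤T-size ε              = refl
≤T-size ((_ , r) ◅ rs) = trans (leftRot-size r) (≤T-size rs)

spine : ℕ → Tree → Tree
spine zero    X = X
spine (suc k) X = • ∧ₜ spine k X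

rightComb : ℕ → Tree
rightComb n = spine n •

leftComb : ℕ → Tree
leftComb zero    = •
leftComb (suc n) = leftComb n ∧ₜ •

spine-+ : ∀ m n X → spine (m + n) X ≡ spine m (spine n X)
spine-+ zero    n X = refl
spine-+ (suc m) n X = cong (• ∧ₜ_) (spine-+ m n X)

inSpine : ℕ → Word → Word
inSpine zero    w = w
inSpine (suc k) w = inRight (inSpine k w)

rotates-inSpine : ∀ k → Rotates w A B → Rotates (inSpine k w) (spine k A) (spine k B)
rotates-inSpine zero    rw = rw
rotates-inSpine (suc k) rw = rotates-inRight • (rotates-inSpine k rw)

graft : Tree → Word
graft •        = []
graft (A ∧ₜ B) = graft A ++ (inRight (graft B) ++ ([] ∷ []))

graft-rotates : ∀ T X → Rotates (graft T) (spine (suc (size T)) X) (T ∧ₜ X)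
graft-rotates •        X = []
graft-rotates (A ∧ₜ B) X = subst (λ Z → Rotates (graft (A ∧ₜ B)) Z ((A ∧ₜ B) ∧ₜ X)) (sym split-spine)
  (rotates-++ (graft-rotates A (spine (suc (size B)) X))
    (rotates-++ (rotates-inRight A (graft-rotates B X)) (rot-here A B X ∷ [])))
  where
  split-spine : spine (suc (size (A ∧ₜ B))) X ≡ spine (suc (size A)) (spine (suc (size B)) X)
  split-spine = trans (cong (λ z → spine (suc z) X) (sym (+-suc (size A) (size B))))
                      (spine-+ (suc (size A)) (suc (size B)) X)

wordOf : Tree → Word
wordOf •        = []
wordOf (A ∧ₜ B) = inSpine (suc (size A)) (wordOf B) ++ graft A

wordOf-rotates : ∀ T → Rotates (wordOf T) (rightComb (size T)) T
wordOf-rotates •        = []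
wordOf-rotates (A ∧ₜ B) =
  subst (λ Z → Rotates (wordOf (A ∧ₜ B)) Z (A ∧ₜ B)) (sym (spine-+ (suc (size A)) (size B) •))
  (rotates-++ (rotates-inSpine (suc (size A)) (wordOf-rotates B)) (graft-rotates A B))

wordOf-rotates-𝒯 : ∀ {n} (T : 𝒯 n) → Rotates (wordOf (proj₁ T)) (rightComb n) (proj₁ T)
wordOf-rotates-𝒯 (T , refl) = wordOf-rotates T

size-rightComb : ∀ n → size (rightComb n) ≡ n
size-rightComb zero    = refl
size-rightComb (suc n) = cong suc (size-rightComb n)

-- leftComb k ∧ T rotates into a left comb: rotate at the root, then treat
-- the two subtrees of T one after the other.
attach : ∀ k T → ∃[ w ] Rotates w (leftComb k ∧ₜ T) (leftComb (suc (k + size T)))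
attach k • = [] , subst (λ z → Rotates [] (leftComb k ∧ₜ •) (leftComb (suc z))) (sym (+-identityʳ k)) []
attach k (B₀ ∧ₜ B₁) with attach k B₀
... | w₀ , r₀ with attach (suc (k + size B₀)) B₁
... | w₁ , r₁ = [] ∷ inLeft w₀ ++ w₁ ,
  rot-here (leftComb k) B₀ B₁ ∷ rotates-++ (rotates-inLeft B₁ r₀)
    (subst (λ z → Rotates w₁ (leftComb (suc (k + size B₀)) ∧ₜ B₁) (leftComb (suc z))) sizes r₁)
  where
  sizes : suc (k + size B₀) + size B₁ ≡ k + suc (size B₀ + size B₁)
  sizes = trans (cong suc (+-assoc k (size B₀) (size B₁))) (sym (+-suc k (size B₀ + size B₁)))

toLeftComb : ∀ T → ∃[ w ] Rotates w T (leftComb (size T))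
toLeftComb •          = [] , []
toLeftComb (T₀ ∧ₜ T₁) with toLeftComb T₀ | attach (size T₀) T₁
... | w₀ , r₀ | w₁ , r₁ = inLeft w₀ ++ w₁ , rotates-++ (rotates-inLeft T₁ r₀) r₁

power-rotates : ∀ m → Rotates (a∅^ m) (rightComb (suc m)) (leftComb (suc m))
power-rotates m = peel 0 m
  where
  peel : ∀ j m → Rotates (a∅^ m) (leftComb j ∧ₜ rightComb m) (leftComb (suc (j + m)))
  peel j zero    = subst (λ z → Rotates [] (leftComb j ∧ₜ •) (leftComb (suc z))) (sym (+-identityʳ j)) []
  peel j (suc m) = rot-here (leftComb j) • (rightComb m)
    ∷ subst (λ z → Rotates (a∅^ m) (leftComb (suc j) ∧ₜ rightComb m) (leftComb (suc z)))
            (sym (+-suc j m)) (peel (suc j) m)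

ι-leftRot : LeftRot α A B → LeftRot α (ι A) (ι B)
ι-leftRot (rot-here t₀ t₁ t₂) = rot-here t₀ t₁ (ι t₂)
ι-leftRot (rot-0 u r)         = rot-0 (ι u) r
ι-leftRot (rot-1 t r)         = rot-1 t (ι-leftRot r)

rotates-ιⁿ : ∀ k → Rotates w A B → Rotates w (ιⁿ k A) (ιⁿ k B)
rotates-ιⁿ zero    rw = rw
rotates-ιⁿ (suc k) rw = rotates-image ι ι-leftRot (rotates-ιⁿ k rw)

ιⁿ-rightComb : ∀ k n → ιⁿ k (rightComb n) ≡ rightComb (k + n)
ιⁿ-rightComb zero    n = refl
ιⁿ-rightComb (suc k) n = trans (cong ι (ιⁿ-rightComb k n)) (ι-spine (k + n))
  where
  ι-spine : ∀ n → ι (rightComb n) ≡ rightComb (suc n)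
  ι-spine zero    = refl
  ι-spine (suc n) = cong (• ∧ₜ_) (ι-spine n)

wordOf-rotates-at : ∀ {n} (T : 𝒯 n) N → n ≤ N → Rotates (wordOf (proj₁ T)) (rightComb N) (ιⁿ (N ∸ n) (proj₁ T))
wordOf-rotates-at {n} (T , refl) N n≤N =
  subst (λ Z → Rotates (wordOf T) Z (ιⁿ (N ∸ n) T))
    (trans (ιⁿ-rightComb (N ∸ n) n) (cong rightComb (m∸n+n≡m n≤N)))
    (rotates-ιⁿ (N ∸ n) (wordOf-rotates T))

double : Tree → Tree
double •        = • ∧ₜ •
double (x ∧ₜ y) = double x ∧ₜ double y

expand : ℕ → Tree → Tree
expand zero    W = W
expand (suc D) W = double (expand D W)

double-leftRot : LeftRot α A B → LeftRot α (double A) (double B)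
double-leftRot (rot-here t₀ t₁ t₂) = rot-here (double t₀) (double t₁) (double t₂)
double-leftRot (rot-0 u r)         = rot-0 (double u) (double-leftRot r)
double-leftRot (rot-1 t r)         = rot-1 (double t) (double-leftRot r)

rotates-expand : ∀ D → Rotates w A B → Rotates w (expand D A) (expand D B)
rotates-expand zero    rw = rw
rotates-expand (suc D) rw = rotates-image double double-leftRot (rotates-expand D rw)

Deep : ℕ → Tree → Set
Deep zero    _        = ⊤
Deep (suc d) •        = ⊥
Deep (suc d) (x ∧ₜ y) = Deep d x × Deep d y

deep-weaken : ∀ {m n} X → m ≤ n → Deep n X → Deep m X
deep-weaken X        z≤n       _          = tt
deep-weaken (x ∧ₜ y) (s≤s m≤n) (dx , dy) = deep-weaken x m≤n dx , deep-weaken y m≤n dy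

deep-pred : ∀ X → Deep (suc d) X → Deep d X
deep-pred {d} X = deep-weaken X (n≤1+n d)

deep-double : ∀ d X → Deep d X → Deep (suc d) (double X)
deep-double zero    •        _         = tt , tt
deep-double zero    (x ∧ₜ y) _         = tt , tt
deep-double (suc d) (x ∧ₜ y) (dx , dy) = deep-double d x dx , deep-double d y dy

deep-expand : ∀ D W → Deep D (expand D W)
deep-expand zero    W = tt
deep-expand (suc D) W = deep-double D (expand D W) (deep-expand D W)

leftRot-exists : ∀ α X → Deep (2 + len α) X → ∃[ X′ ] LeftRot α X X′
leftRot-exists []       (x ∧ₜ (y ∧ₜ z)) _         = _ , rot-here x y z
leftRot-exists (b0 ∷ α) (x ∧ₜ y)        (dx , _)  with leftRot-exists α x dx
... | x′ , r = x′ ∧ₜ y , rot-0 y r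
leftRot-exists (b1 ∷ α) (x ∧ₜ y)        (_ , dy)  with leftRot-exists α y dy
... | y′ , r = x ∧ₜ y′ , rot-1 x r

leftRot-deep : ∀ d → LeftRot α X X′ → Deep (suc d) X → Deep d X′
leftRot-deep zero          _                  _              = tt
leftRot-deep (suc zero)    (rot-here _ _ _)   (_ , _ , d₂)   = tt , d₂
leftRot-deep (suc (suc d)) (rot-here t₀ t₁ _) (d₀ , d₁ , d₂) = (deep-pred t₀ (deep-pred t₀ d₀) , deep-pred t₁ d₁) , d₂
leftRot-deep (suc d)       (rot-0 u r)        (dx , du)      = leftRot-deep d r dx , deep-pred u du
leftRot-deep (suc d)       (rot-1 t r)        (dt , dy)      = deep-pred t dt , leftRot-deep d r dy

cost : Word → ℕ
cost []      = 0
cost (α ∷ w) = (2 + len α) + cost w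

rotates-exists : ∀ w X → Deep (cost w) X → ∃[ Y ] Rotates w X Y
rotates-exists []      X _  = X , []
rotates-exists (α ∷ w) X dX with leftRot-exists α X (deep-weaken X (m≤m+n (2 + len α) (cost w)) dX)
... | X′ , r with rotates-exists w X′ (leftRot-deep (cost w) r (deep-weaken X (s≤s (m≤n+m (cost w) (suc (len α)))) dX))
... | Y , rw = Y , r ∷ rw

-- Doubled W Z : Z = double W, as an inductive relation one can match on.
data Doubled : Tree → Tree → Set where
  leaf : Doubled • (• ∧ₜ •)
  node : ∀ {W₀ W₁ Z₀ Z₁} → Doubled W₀ Z₀ → Doubled W₁ Z₁ → Doubled (W₀ ∧ₜ W₁) (Z₀ ∧ₜ Z₁)

doubled-double : ∀ W → Doubled W (double W)
doubled-double •        = leaf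
doubled-double (x ∧ₜ y) = node (doubled-double x) (doubled-double y)

doubled⇒double : Doubled W Z → Z ≡ double W
doubled⇒double leaf         = refl
doubled⇒double (node d₀ d₁) = cong₂ _∧ₜ_ (doubled⇒double d₀) (doubled⇒double d₁)

doubled-functional : Doubled W Z → Doubled W′ Z → W ≡ W′
doubled-functional leaf         leaf           = refl
doubled-functional (node d₀ d₁) (node d₀′ d₁′) = cong₂ _∧ₜ_ (doubled-functional d₀ d₀′) (doubled-functional d₁ d₁′)

doubled-leftRot : LeftRot α Z Z′ → Doubled W Z → Doubled W′ Z′ → LeftRot α W W′
doubled-leftRot (rot-here _ _ _) (node _ leaf) (node _ ())
doubled-leftRot (rot-here _ _ _) (node d₀ (node d₁ d₂)) (node (node d₀′ d₁′) d₂′)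
  with refl ← doubled-functional d₀ d₀′ | refl ← doubled-functional d₁ d₁′ | refl ← doubled-functional d₂ d₂′
  = rot-here _ _ _
doubled-leftRot (rot-0 u r) (node d₀ d₁) (node d₀′ d₁′) with refl ← doubled-functional d₁ d₁′
  = rot-0 _ (doubled-leftRot r d₀ d₀′)
doubled-leftRot (rot-1 t r) (node d₀ d₁) (node d₀′ d₁′) with refl ← doubled-functional d₀ d₀′
  = rot-1 _ (doubled-leftRot r d₁ d₁′)

-- The side (left or right child) of every leaf, from left to right.  A left
-- rotation can only turn left leaves into right ones.
data Side : Set where
  left right : Side

sides : Side → Tree → List Side
sides s •        = s ∷ []
sides s (x ∧ₜ y) = sides left x ++ sides right y

data _⊑_ : Side → Side → Set where
  stay      : ∀ {s} → s ⊑ s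
  left⊑right : left ⊑ right

⊑-trans : ∀ {s s′ s″} → s ⊑ s′ → s′ ⊑ s″ → s ⊑ s″
⊑-trans stay       q    = q
⊑-trans left⊑right stay = left⊑right

_≼_ : List Side → List Side → Set
_≼_ = Pointwise _⊑_

≼-refl : ∀ {xs} → xs ≼ xs
≼-refl = Pointwise.refl stay

sides-leftRot : LeftRot α X X′ → ∀ s → sides s X ≼ sides s X′
sides-leftRot (rot-here t₀ t₁ t₂) s rewrite ++-assoc (sides left t₀) (sides right t₁) (sides right t₂) =
  Pointwise.++⁺ (≼-refl {sides left t₀}) (Pointwise.++⁺ (left≼right t₁) (≼-refl {sides right t₂}))
  where
  left≼right : ∀ T → sides left T ≼ sides right T
  left≼right •        = left⊑right ∷ []
  left≼right (_ ∧ₜ _) = ≼-refl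
sides-leftRot (rot-0 u r) s = Pointwise.++⁺ (sides-leftRot r left) ≼-refl
sides-leftRot (rot-1 t r) s = Pointwise.++⁺ ≼-refl (sides-leftRot r right)

sides-≤T : X ≤T X′ → ∀ s → sides s X ≼ sides s X′
sides-≤T ε              s = ≼-refl
sides-≤T ((_ , r) ◅ rs) s = Pointwise.transitive ⊑-trans (sides-leftRot r s) (sides-≤T rs s)

-- The sides of a doubled tree read (left right)(left right)⋯ ; conversely
-- (halving below) such trees are doubled.
data Paired : List Side → Set where
  []   : Paired []
  pair : ∀ {xs} → Paired xs → Paired (left ∷ right ∷ xs)

paired-++ : ∀ {xs ys} → Paired xs → Paired ys → Paired (xs ++ ys)
paired-++ []        q = q
paired-++ (pair p) q = pair (paired-++ p q)

doubled-paired : Doubled W Z → ∀ s → Paired (sides s Z)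
doubled-paired leaf         s = pair []
doubled-paired (node d₀ d₁) s = paired-++ (doubled-paired d₀ left) (doubled-paired d₁ right)

paired-between : ∀ {xs ys zs} → xs ≼ ys → ys ≼ zs → Paired xs → Paired zs → Paired ys
paired-between []                  []                  []        []        = []
paired-between (stay ∷ stay ∷ p)   (stay ∷ stay ∷ q)   (pair hx) (pair hz) = pair (paired-between p q hx hz)
paired-between (left⊑right ∷ _)    (() ∷ _)            (pair _)  (pair _)

data EndsRight : List Side → Set where
  last : EndsRight (right ∷ [])
  _∷_  : ∀ s {xs} → EndsRight xs → EndsRight (s ∷ xs)

endsRight-++ : ∀ xs {ys} → EndsRight ys → EndsRight (xs ++ ys)
endsRight-++ []       e = e
endsRight-++ (s ∷ xs) e = s ∷ endsRight-++ xs e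

sides-right-endsRight : ∀ T → EndsRight (sides right T)
sides-right-endsRight •        = last
sides-right-endsRight (x ∧ₜ y) = endsRight-++ (sides left x) (sides-right-endsRight y)

paired-split : ∀ xs {ys} → EndsRight xs → Paired (xs ++ ys) → Paired xs × Paired ys
paired-split (_ ∷ _ ∷ []) (_ ∷ last) (pair p) = pair [] , p
paired-split (_ ∷ _ ∷ xs) (_ ∷ _ ∷ e) (pair p) with paired-split xs e p
... | pxs , pys = pair pxs , pys

sides-left-head : ∀ T → ∃[ rest ] sides left T ≡ left ∷ rest
sides-left-head •        = [] , refl
sides-left-head (x ∧ₜ y) with sides-left-head x
... | rest , e rewrite e = rest ++ sides right y , refl

-- Reading the pairs back off: a tree with paired sides is doubled.  (A left
-- leaf directly followed by another left leaf would break the pairing.)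
halving : ∀ s X → Paired (sides s X) → ∃[ W ] Doubled W X
halving s •                 ()
halving s (• ∧ₜ •)          p = • , leaf
halving s (• ∧ₜ (y₀ ∧ₜ y₁)) p with sides-left-head y₀
... | rest , e with subst (λ z → Paired (left ∷ z ++ sides right y₁)) e p
... | ()
halving s ((x₀ ∧ₜ x₁) ∧ₜ y) p =
  let p₀ , p₁ = paired-split (sides left (x₀ ∧ₜ x₁)) (endsRight-++ (sides left x₀) (sides-right-endsRight x₁)) p
      W₀ , d₀ = halving left (x₀ ∧ₜ x₁) p₀
      W₁ , d₁ = halving right y p₁
  in W₀ ∧ₜ W₁ , node d₀ d₁

doubled-between : Doubled A Z → Doubled B Z′ → Z ≤T X → X ≤T Z′ → ∃[ W ] Doubled W X
doubled-between {X = X} dA dB p q =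
  halving left X (paired-between (sides-≤T p left) (sides-≤T q left) (doubled-paired dA left) (doubled-paired dB left))

doubled-reflects : Doubled A Z → Doubled B Z′ → Z ≤T Z′ → A ≤T B
doubled-reflects dA dB ε with refl ← doubled-functional dA dB = ε
doubled-reflects dA dB ((α , r) ◅ rs) with doubled-between dA dB ((α , r) ◅ ε) rs
... | W , dW = (α , doubled-leftRot r dA dW) ◅ doubled-reflects dW dB rs

expand-reflects : ∀ D → expand D A ≤T expand D B → A ≤T B
expand-reflects zero    p = p
expand-reflects (suc D) p = expand-reflects D (doubled-reflects (doubled-double _) (doubled-double _) p)

expand-between : ∀ D → expand D A ≤T X → X ≤T expand D B → ∃[ W ] X ≡ expand D W
expand-between {X = X} zero _ _ = X , refl
expand-between {A = A} {B = B} (suc D) p q with doubled-between (doubled-double (expand D A)) (doubled-double (expand D B)) p q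
... | W₁ , d₁ with expand-between D (doubled-reflects (doubled-double _) d₁ p) (doubled-reflects d₁ (doubled-double _) q)
... | W , refl = W , doubled⇒double d₁

≈F-sym : p ≈F q → q ≈F p
≈F-sym E t 0≤t t≤1 = sym (E t 0≤t t≤1)

perform : ∀ w S → ∃[ Y ] Rotates w (expand (cost w) S) Y
perform w S = rotates-exists w (expand (cost w) S) (deep-expand (cost w) S)

-- Proof: on a deep enough expansion of S the word p h
-- acts as well; its prefix p reaches the expansion of A, and the whole word
-- reaches the expansion of B because it denotes q.  Expansion reflects ≤T.
divisor-below : Rotates p S A → Rotates q S B → q ≈F (p ++ h) → A ≤T B
divisor-below {p} {S} {A} {q} {B} {h} rp rq E
  with perform (p ++ h) S
... | Y , rph with rotates-split p rph
... | X , rp′ , rh =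
  expand-reflects D (subst₂ _≤T_ (rotates-functional rp′ (rotates-expand D rp))
                                 (rotations-separate rph (rotates-expand D rq) (≈F-sym {q} {p ++ h} E))
                                 (rotates⇒≤T rh))
  where D = cost (p ++ h)

-- If f = g g′ in F and f acts on S, then g acts on S as well, reaching a tree W
-- above S: on a deep expansion of S, g reaches a tree between the expansions
-- of S and of the target of f, hence itself an expansion.
divisor-realized : Rotates f S B → f ≈F (g ++ g′) →
  ∃[ W ] S ≤T W × (∀ {p} → Rotates p S W → g ≈F p)
divisor-realized {f} {S} {B} {g} {g′} rf E
  with perform (g ++ g′) S
... | Y , rgg with rotates-split g rgg
... | X , rg , rg′
  with refl ← rotations-separate (rotates-expand (cost (g ++ g′)) rf) rgg E
  with expand-between (cost (g ++ g′)) (rotates⇒≤T rg) (rotates⇒≤T rg′)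
... | W , refl = W , expand-reflects D (rotates⇒≤T rg) , λ rp → rotations-agree rg (rotates-expand D rp)
  where D = cost (g ++ g′)

≤T⇒⪯ : Rotates p S A → Rotates q S B → A ≤T B → p ⪯ q
≤T⇒⪯ rp rq A≤B with ≤T⇒rotates A≤B
... | h , rh = h , rotations-agree rq (rotates-++ rp rh)

⪯⇒≤T : Rotates p S A → Rotates q S B → p ⪯ q → A ≤T B
⪯⇒≤T rp rq (h , E) = divisor-below rp rq E

-- Any word turning the right comb of size N + 1 into some tree divides a_∅^N:
-- it can be completed to a word turning the right comb into the left comb.
divides-power : ∀ {w N T} → Rotates w (rightComb (suc N)) T → w ⪯ a∅^ N
divides-power {w} {N} {T} rw with toLeftComb T
... | h , rh = h , rotations-agree (power-rotates N) (rotates-++ rw (subst (Rotates h T ∘ leftComb) size≡ rh))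
  where
  size≡ : size T ≡ suc N
  size≡ = trans (sym (≤T-size (rotates⇒≤T rw))) (size-rightComb (suc N))

divisor-is-word : ∀ k g → g ⪯ a∅^ k → Σ (𝒯 (suc k)) λ T → wordOf (proj₁ T) ≈F g
divisor-is-word k g (g′ , H) with divisor-realized {g = g} {g′ = g′} (power-rotates k) H
... | W , above , agree = T , λ t 0≤t t≤1 → sym (agree (wordOf-rotates-𝒯 T) t 0≤t t≤1)
  where
  T : 𝒯 (suc k)
  T = W , trans (sym (≤T-size above)) (size-rightComb (suc k))

𝒯-ext : ∀ {n} {T T′ : 𝒯 n} → proj₁ T ≡ proj₁ T′ → T ≡ T′
𝒯-ext {T = t , e} {.t , e′} refl = cong (t ,_) (≡-irrelevant e e′)

divIso : ∀ m → IsoDivTamari (suc m)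
divIso m = Φ , injective , surjective , λ T T′ → ≤T⇒⪯ (r T) (r T′) , ⪯⇒≤T (r T) (r T′)
  where
  r = wordOf-rotates-𝒯
  Φ : 𝒯 (suc m) → Div (a∅^ m)
  Φ T = wordOf (proj₁ T) , divides-power (r T)
  injective : ∀ T T′ → proj₁ (Φ T) ≈F proj₁ (Φ T′) → T ≡ T′
  injective T T′ E = 𝒯-ext (rotations-separate (r T) (r T′) E)
  surjective : ∀ (g : Div (a∅^ m)) → Σ (𝒯 (suc m)) λ T → proj₁ (Φ T) ≈F proj₁ g
  surjective (g , g⪯) = divisor-is-word m g g⪯

-- Second part: the same map, read at a common level N of two trees (where ι
-- merely extends the right comb), is an isomorphism 𝒯_∞ ≅ ⋃_n Div(a_∅^n).
unionIso : IsoUnionTamari∞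
unionIso = Ψ , respects , reflects , surjective , order
  where
  at : ∀ {n} (T : 𝒯 n) N → n ≤ N → Rotates (wordOf (proj₁ T)) (rightComb N) (ιⁿ (N ∸ n) (proj₁ T))
  at = wordOf-rotates-at
  Ψ : 𝒯∞ → DivUnion
  Ψ (n , T) = wordOf (proj₁ T) , suc n , s≤s z≤n , divides-power (at T (2 + n) (m≤n+m n 2))
  respects : ∀ x y → x ≈∞ y → proj₁ (Ψ x) ≈F proj₁ (Ψ y)
  respects (n , T) (m , U) (N , n≤N , m≤N , e) =
    rotations-agree (at T N n≤N) (subst (Rotates _ (rightComb N)) (sym e) (at U N m≤N))
  reflects : ∀ x y → proj₁ (Ψ x) ≈F proj₁ (Ψ y) → x ≈∞ y
  reflects (n , T) (m , U) E =
    n + m , m≤m+n n m , m≤n+m m n , rotations-separate (at T (n + m) (m≤m+n n m)) (at U (n + m) (m≤n+m m n)) E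
  surjective : ∀ (g : DivUnion) → Σ 𝒯∞ λ x → proj₁ (Ψ x) ≈F proj₁ g
  surjective (g , k , _ , g⪯) with divisor-is-word k g g⪯
  ... | T , E = (suc k , T) , E
  order : ∀ x y → (x ≤∞ y → proj₁ (Ψ x) ⪯ proj₁ (Ψ y)) × (proj₁ (Ψ x) ⪯ proj₁ (Ψ y) → x ≤∞ y)
  order (n , T) (m , U) =
    (λ { (N , n≤N , m≤N , st) → ≤T⇒⪯ (at T N n≤N) (at U N m≤N) st }) ,
    λ d → n + m , m≤m+n n m , m≤n+m m n , ⪯⇒≤T (at T (n + m) (m≤m+n n m)) (at U (n + m) (m≤n+m m n)) d

proposition3p9 : ((n : ℕ) → 1 ≤ n → IsoDivTamari n) × IsoUnionTamari∞
proposition3p9 = (λ { (suc m) _ → divIso m }) , unionIso
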